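{- Let $n\ge1$ and $0\le j\le n$ be integers. Then \[ |\mathrm{Orb}_{odd}(C_n,\mathrm{Neck}(n,j))^f| = \begin{cases} \binom{\frac{n}{2^{\nu_2(n)+1}}-\frac12}{\frac{j}{2^{\nu_2(n)+1}}}, & \text{if } \nu_2(j)>\nu_2(n),\\[4pt] \binom{\frac{n}{2^{\nu_2(j)+1}}-\frac12}{\frac{j}{2^{\nu_2(j)+1}}-\frac12}, & \text{if } \nu_2(j) = \nu_2(n),\\[4pt] 0, & \text{if } \nu_2(j)<\nu_2(n). \end{cases} \]
   Context: $\nu_2$ is the $2$-adic valuation, with $\nu_2(0)=+\infty$. $\mathrm{Neck}(n,j)$ is the set of colorings of $n$ positions $\mathbb Z/n$ (arranged on a circle) with $j$ blue and $n-j$ red beads; $C_n$ acts by rotation $m\mapsto m+1$ and the flip $f$ by $m\mapsto-m$, which acts on the set of rotation orbits. $\mathrm{Orb}_{odd}(C_n,\mathrm{Neck}(n,j))^f$ is the set of rotation orbits of odd cardinality that are fixed by $f$. -}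

module Defs where

open import Data.Bool using (Bool; true; false; if_then_else_)
import Data.Bool as B
open import Data.Nat using (ℕ; zero; suc; _+_; _*_; _∸_; _^_; _/_; _%_; _<_; _≟_; _<ᵇ_)
open import Data.Nat.Properties using (m^n≢0)
open import Data.Nat.Combinatorics using (_C_)
open import Data.Vec using (Vec; []; _∷_; _∷ʳ_; reverse)
import Data.Vec.Properties as VP
open import Data.List using (List; []; _∷_; map; _++_; filter; length; deduplicate; upTo)
open import Data.List.Relation.Unary.All using (All; all?)
open import Data.List.Membership.Propositional using (_∈_)
import Data.List.Membership.DecPropositional as DecMem
open import Data.Product using (_×_)
open import Relation.Nullary using (Dec)
open import Relation.Nullary.Decidable using (_×-dec_)
open import Relation.Binary.PropositionalEquality using (_≡_)

data ℕ∞ : Set where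
  fin : ℕ → ℕ∞
  ∞   : ℕ∞

-- ν₂-fuel f k : number of times 2 divides k (fuel f ≥ k suffices for k ≥ 1)
ν₂-fuel : ℕ → ℕ → ℕ
ν₂-fuel zero    k = 0
ν₂-fuel (suc f) zero = 0
ν₂-fuel (suc f) (suc k) with suc k % 2
... | zero  = suc (ν₂-fuel f (suc k / 2))
... | suc _ = 0

ν₂ : ℕ → ℕ∞
ν₂ zero    = ∞
ν₂ (suc k) = fin (ν₂-fuel (suc k) (suc k))

-- Colorings of ℤ/n: position m ↦ (true = blue, false = red)

Coloring : ℕ → Set
Coloring n = Vec Bool n

_≟c_ : ∀ {n} (c d : Coloring n) → Dec (c ≡ d)
_≟c_ = VP.≡-dec B._≟_

allColorings : (n : ℕ) → List (Coloring n)
allColorings zero    = [] ∷ []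
allColorings (suc n) = map (true ∷_) (allColorings n) ++ map (false ∷_) (allColorings n)

blues : ∀ {n} → Coloring n → ℕ
blues []            = 0
blues (true  ∷ c) = suc (blues c)
blues (false ∷ c) = blues c

Neck : (n j : ℕ) → List (Coloring n)
Neck n j = filter (λ c → blues c ≟ j) (allColorings n)

-- rotation by one position: (rot c)(m) = c(m+1)
rot : ∀ {n} → Coloring n → Coloring n
rot []      = []
rot (x ∷ c) = c ∷ʳ x

rot^ : ∀ {n} → ℕ → Coloring n → Coloring n
rot^ zero    c = c
rot^ (suc i) c = rot (rot^ i c)

-- the flip m ↦ -m: (flipC c)(m) = c(-m)
flipC : ∀ {n} → Coloring n → Coloring n
flipC []      = []
flipC (x ∷ c) = x ∷ reverse c

orbit : ∀ {n} → Coloring n → List (Coloring n)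
orbit {n} c = deduplicate _≟c_ (map (λ i → rot^ i c) (upTo n))

module _ {n : ℕ} where
  open DecMem (_≟c_ {n}) using (_∈?_)

  SameSet : List (Coloring n) → List (Coloring n) → Set
  SameSet xs ys = All (_∈ ys) xs × All (_∈ xs) ys

  sameSet? : (xs ys : List (Coloring n)) → Dec (SameSet xs ys)
  sameSet? xs ys = all? (_∈? ys) xs ×-dec all? (_∈? xs) ys

Orb : (n j : ℕ) → List (List (Coloring n))
Orb n j = deduplicate sameSet? (map orbit (Neck n j))

FixedByFlip : ∀ {n} → List (Coloring n) → Set
FixedByFlip O = SameSet (map flipC O) O

OddCard : ∀ {n} → List (Coloring n) → Set
OddCard O = length O % 2 ≡ 1

OrbOddFixed : (n j : ℕ) → List (List (Coloring n))
OrbOddFixed n j =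
  filter (λ O → (length O % 2 ≟ 1) ×-dec sameSet? (map flipC O) O) (Orb n j)

-- right-hand side.  For v = ν₂(n) (n ≥ 1), n / 2^(v+1) - 1/2 = (n/2^v - 1)/2,
-- and for ν₂(j) = v, j / 2^(v+1) - 1/2 = (j/2^v - 1)/2, computed exactly in ℕ.

rhs : (n j : ℕ) → ℕ
rhs n j with ν₂ n | ν₂ j
... | ∞     | _     = 0   -- n = 0: excluded by hypothesis n ≥ 1
... | fin v | ∞     = ((n / 2 ^ v ∸ 1) / 2) C (j / 2 ^ (suc v))
  where instance _ = m^n≢0 2 v ; _ = m^n≢0 2 (suc v)
... | fin v | fin w =
  if v <ᵇ w then ((n / 2 ^ v ∸ 1) / 2) C (j / 2 ^ (suc v))
  else if w <ᵇ v then 0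
  else ((n / 2 ^ w ∸ 1) / 2) C ((j / 2 ^ w ∸ 1) / 2)
  where instance _ = m^n≢0 2 v ; _ = m^n≢0 2 (suc v) ; _ = m^n≢0 2 w

-- Write n = 2^v·m with m = 2k+1 odd. A rotation orbit has a size p dividing n, and p is odd
-- exactly when p ∣ m, i.e. when its colorings are fixed by the rotation through m. An orbit of
-- odd size that the flip maps to itself contains exactly one flip-fixed coloring (if
-- flip c = rot^k c, then rot^i c with 2i ≡ k mod p is fixed, and two fixed colorings differ by a
-- rotation whose square is trivial); every other orbit contains none. So the left-hand side
-- counts the colorings fixed by the flip and by the rotation through m. Such a coloring is the
-- 2^v-fold repetition of a palindrome of length 2k+1, which is determined by its first k+1
-- beads; it has 2^v(2b+1) or 2^(v+1)·b blue beads according as its first bead is blue or red,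
-- where b counts the blue beads among the next k. Comparing 2-adic valuations with j, at most
-- one of the two cases contributes, which gives the three cases of the formula.

module Submission where

open import Defs
open import Data.Nat using (ℕ; zero; suc; _+_; _*_; _∸_; _^_; _/_; _%_; _≤_; _<_; _≟_; _<ᵇ_; z≤n; s≤s; s≤s⁻¹; NonZero; ≢-nonZero⁻¹)
open import Data.Nat.Properties
open import Data.Nat.DivMod using (m≡m%n+[m/n]*n; m%n<n; m*n/n≡m; m/n<m; m*[n/m]≡n; [m+kn]%n≡m%n)
open import Data.Nat.Divisibility using (_∣_; divides; ∣-trans; ∣⇒≤; 0∣⇒≡0; m∣m*n; *-cancelˡ-∣; n∣m⇒m%n≡0; m%n≡0⇒n∣m)
open import Data.Nat.Coprimality using (Coprime; coprime-divisor)
open import Data.Nat.Combinatorics using (_C_; nCk+nC[k+1]≡[n+1]C[k+1])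
open import Data.Nat.Tactic.RingSolver using (solve-∀)
open import Data.Bool using (Bool; true; false; T)
import Data.Bool as Bool
open import Data.Vec using ([]; _∷_; toList; fromList)
import Data.Vec.Properties as Vec
open import Data.List using (List; []; _∷_; _++_; [_]; map; filter; length; reverse; take; drop; applyUpTo; upTo; deduplicate)
import Data.List.Properties as List
open import Data.List.Properties using (length-map; length-++; length-applyUpTo; filter-++; filter-none; filter-notAll; filter-accept; filter-reject)
open import Data.List.Membership.Propositional using (_∈_)
open import Data.List.Membership.Propositional.Properties using (∈-filter⁺; ∈-filter⁻; ∈-map⁺; ∈-map⁻; ∈-++⁺ˡ; ∈-++⁺ʳ; ∈-applyUpTo⁺; ∈-applyUpTo⁻; ∈-upTo⁺; ∈-deduplicate⁺; ∈-deduplicate⁻)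
open import Data.List.Relation.Unary.Any using (here; there)
import Data.List.Relation.Unary.Any as Any
open import Data.List.Relation.Unary.All using (All; []; _∷_)
import Data.List.Relation.Unary.All as All
import Data.List.Relation.Unary.All.Properties as AllProps
open import Data.List.Relation.Unary.AllPairs using ([]; _∷_)
open import Data.List.Relation.Unary.Unique.Propositional using (Unique)
import Data.List.Relation.Unary.Unique.Propositional.Properties as Unique
open import Data.List.Relation.Unary.Unique.DecPropositional.Properties using (deduplicate-!)
open import Data.Product using (∃-syntax; _×_; _,_; proj₁; proj₂)
open import Function using (id; _∘_)
open import Level using (0ℓ)
open import Relation.Nullary using (¬_; Dec; yes; no; contradiction)
open import Relation.Nullary.Decidable using (¬?; _×-dec_)
open import Relation.Unary using (Pred; Decidable; ∁; _∩_; U)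
open import Relation.Unary.Properties using (∁?; _∩?_; U?)
open import Relation.Binary.Core using (Rel)
open import Relation.Binary.Structures using (IsEquivalence)
open import Relation.Binary.Definitions using (DecidableEquality; tri<; tri≈; tri>) renaming (Decidable to Decidable₂)
open import Relation.Binary.PropositionalEquality using (_≡_; _≢_; refl; sym; trans; cong; cong₂; subst; ≢-sym; module ≡-Reasoning)
open ≡-Reasoning

private variable n : ℕ

-- Counting in lists

module _ {A : Set} where

  count : {P : Pred A 0ℓ} → Decidable P → List A → ℕ
  count P? = length ∘ filter P?

  count-++ : {P : Pred A 0ℓ} (P? : Decidable P) (xs ys : List A) →
             count P? (xs ++ ys) ≡ count P? xs + count P? ys
  count-++ P? xs ys = trans (cong length (filter-++ P? xs ys)) (length-++ (filter P? xs))

  count-cong : {P Q : Pred A 0ℓ} (P? : Decidable P) (Q? : Decidable Q) (xs : List A) →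
               (∀ {x} → x ∈ xs → P x → Q x) → (∀ {x} → x ∈ xs → Q x → P x) →
               count P? xs ≡ count Q? xs
  count-cong P? Q? []       _   _   = refl
  count-cong P? Q? (x ∷ xs) P⇒Q Q⇒P with P? x | Q? x
  ... | yes _  | yes _  = cong suc (count-cong P? Q? xs (P⇒Q ∘ there) (Q⇒P ∘ there))
  ... | no  _  | no  _  = count-cong P? Q? xs (P⇒Q ∘ there) (Q⇒P ∘ there)
  ... | yes Px | no ¬Qx = contradiction (P⇒Q (here refl) Px) ¬Qx
  ... | no ¬Px | yes Qx = contradiction (Q⇒P (here refl) Qx) ¬Px

  count-none : {P : Pred A 0ℓ} (P? : Decidable P) (xs : List A) → All (∁ P) xs → count P? xs ≡ 0
  count-none P? _ ¬Ps = cong length (filter-none P? ¬Ps)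

  count-filter : {P S : Pred A 0ℓ} (P? : Decidable P) (S? : Decidable S) (xs : List A) →
                 count P? (filter S? xs) ≡ count (S? ∩? P?) xs
  count-filter P? S? []       = refl
  count-filter P? S? (x ∷ xs) with S? x
  ... | no  _ = count-filter P? S? xs
  ... | yes _ with P? x
  ...   | yes _ = cong suc (count-filter P? S? xs)
  ...   | no  _ = count-filter P? S? xs

  count-split : {P S : Pred A 0ℓ} (P? : Decidable P) (S? : Decidable S) (xs : List A) →
                count P? xs ≡ count (P? ∩? S?) xs + count (P? ∩? ∁? S?) xs
  count-split P? S? []       = refl
  count-split P? S? (x ∷ xs) with P? x | S? x
  ... | yes _ | yes _ = cong suc (count-split P? S? xs)
  ... | yes _ | no  _ = trans (cong suc (count-split P? S? xs)) (sym (+-suc _ _))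
  ... | no  _ | _     = count-split P? S? xs

module _ {A B : Set} where

  count-map : {P : Pred B 0ℓ} (P? : Decidable P) (f : A → B) (xs : List A) →
              count P? (map f xs) ≡ count (P? ∘ f) xs
  count-map P? f []       = refl
  count-map P? f (x ∷ xs) with P? (f x)
  ... | yes _ = cong suc (count-map P? f xs)
  ... | no  _ = count-map P? f xs

module WithDecidableEquality {A : Set} (_≟_ : DecidableEquality A) where

  Unique-⊆⇒length-≤ : {xs ys : List A} → Unique xs → (∀ {x} → x ∈ xs → x ∈ ys) →
                      length xs ≤ length ys
  Unique-⊆⇒length-≤ {[]}     _            _   = z≤n
  Unique-⊆⇒length-≤ {x ∷ xs} {ys} (x∉xs ∷ !xs) xs⊆ys = ≤-<-trans
    (Unique-⊆⇒length-≤ !xs xs⊆ys-x)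
    (filter-notAll (¬? ∘ (x ≟_)) ys (Any.map (λ x≡y x≢y → x≢y x≡y) (xs⊆ys (here refl))))
    where
    xs⊆ys-x : ∀ {y} → y ∈ xs → y ∈ filter (¬? ∘ (x ≟_)) ys
    xs⊆ys-x y∈xs = ∈-filter⁺ (¬? ∘ (x ≟_)) (xs⊆ys (there y∈xs)) (All.lookup x∉xs y∈xs)

  count-≡1 : {P : Pred A 0ℓ} (P? : Decidable P) {xs : List A} {x₀ : A} → Unique xs →
             x₀ ∈ xs → P x₀ → (∀ {x} → x ∈ xs → P x → x ≡ x₀) → count P? xs ≡ 1
  count-≡1 P? !xs x₀∈xs Px₀ only-x₀ = ≤-antisym
    (Unique-⊆⇒length-≤ {ys = [ _ ]} (Unique.filter⁺ P? !xs)
      (λ x∈ → let (x∈xs , Px) = ∈-filter⁻ P? x∈ in here (only-x₀ x∈xs Px)))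
    (Unique-⊆⇒length-≤ {xs = [ _ ]} ([] ∷ []) (λ { (here refl) → ∈-filter⁺ P? x₀∈xs Px₀ }))

module _ {A B : Set} {f : A → B} (g : B → A) where

  Unique-map⁺-retraction : {xs : List A} → (∀ {x} → x ∈ xs → g (f x) ≡ x) →
                           Unique xs → Unique (map f xs)
  Unique-map⁺-retraction {[]}     _  []           = []
  Unique-map⁺-retraction {x ∷ xs} gf (x∉xs ∷ !xs) =
    AllProps.map⁺ (All.tabulate fx≢) ∷ Unique-map⁺-retraction (gf ∘ there) !xs
    where
    fx≢ : ∀ {y} → y ∈ xs → f x ≢ f y
    fx≢ y∈xs fx≡fy = All.lookup x∉xs y∈xs
      (trans (sym (gf (here refl))) (trans (cong g fx≡fy) (gf (there y∈xs))))

module _ {A B : Set} (_≟_ : DecidableEquality B) where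
  open WithDecidableEquality _≟_

  count-≤-by-retraction : {P : Pred A 0ℓ} {Q : Pred B 0ℓ} (P? : Decidable P) (Q? : Decidable Q)
    {xs : List A} {ys : List B} (f : A → B) (g : B → A) → Unique xs →
    (∀ {x} → x ∈ xs → P x → f x ∈ ys × Q (f x)) →
    (∀ {x} → x ∈ xs → P x → g (f x) ≡ x) →
    count P? xs ≤ count Q? ys
  count-≤-by-retraction P? Q? {xs} {ys} f g !xs maps-to retract =
    subst (_≤ count Q? ys) (length-map f (filter P? xs)) (Unique-⊆⇒length-≤ !image image⊆)
    where
    !image : Unique (map f (filter P? xs))
    !image = Unique-map⁺-retraction g
      (λ x∈ → let (x∈xs , Px) = ∈-filter⁻ P? x∈ in retract x∈xs Px) (Unique.filter⁺ P? !xs)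
    image⊆ : ∀ {y} → y ∈ map f (filter P? xs) → y ∈ filter Q? ys
    image⊆ y∈ with x , x∈ , refl ← ∈-map⁻ f y∈ =
      let (x∈xs , Px) = ∈-filter⁻ P? x∈ ; (fx∈ys , Qfx) = maps-to x∈xs Px in ∈-filter⁺ Q? fx∈ys Qfx

count-≡-by-inverses : {A B : Set} → DecidableEquality A → DecidableEquality B →
  {P : Pred A 0ℓ} {Q : Pred B 0ℓ} (P? : Decidable P) (Q? : Decidable Q)
  {xs : List A} {ys : List B} (f : A → B) (g : B → A) → Unique xs → Unique ys →
  (∀ {x} → x ∈ xs → P x → f x ∈ ys × Q (f x)) → (∀ {y} → y ∈ ys → Q y → g y ∈ xs × P (g y)) →
  (∀ {x} → x ∈ xs → P x → g (f x) ≡ x) → (∀ {y} → y ∈ ys → Q y → f (g y) ≡ y) →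
  count P? xs ≡ count Q? ys
count-≡-by-inverses _≟A_ _≟B_ P? Q? f g !xs !ys f-maps-to g-maps-to gf fg = ≤-antisym
  (count-≤-by-retraction _≟B_ P? Q? f g !xs f-maps-to gf)
  (count-≤-by-retraction _≟A_ Q? P? g f !ys g-maps-to fg)

module CountClasses {A B : Set} (g : A → B) {R : Rel B 0ℓ} (R? : Decidable₂ R) (isEquivalence : IsEquivalence R)
  {P : Pred B 0ℓ} (P? : Decidable P) {Q : Pred A 0ℓ} (Q? : Decidable Q) where
  open IsEquivalence isEquivalence using () renaming (refl to R-refl; sym to R-sym; trans to R-trans)

  ClassCount : (S : Pred B 0ℓ) → List A → Set
  ClassCount S xs = ∀ {x} → x ∈ xs → S (g x) → count (Q? ∩? (R? (g x) ∘ g)) xs ≡ count P? [ g x ]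

  -- S marks the classes that deduplicate has not yet removed; closing S under R keeps the
  -- hypothesis valid on the tail of the list.
  count-deduplicate-∩ : {S : Pred B 0ℓ} (S? : Decidable S) → (∀ {b c} → R b c → S b → S c) →
    (xs : List A) → ClassCount S xs →
    count (S? ∩? P?) (deduplicate R? (map g xs)) ≡ count ((S? ∘ g) ∩? Q?) xs
  count-deduplicate-∩ S? S-resp [] _ = refl
  count-deduplicate-∩ {S} S? S-resp (x ∷ xs) classes = begin
    count (S? ∩? P?) ([ g x ] ++ filter (∁? (R? (g x))) D)
      ≡⟨ count-++ (S? ∩? P?) [ g x ] (filter (∁? (R? (g x))) D) ⟩
    count (S? ∩? P?) [ g x ] + count (S? ∩? P?) (filter (∁? (R? (g x))) D)
      ≡⟨ cong₂ _+_ class-of-x other-classes ⟨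
    count (T? ∩? x~?) (x ∷ xs) + count (T? ∩? ∁? x~?) (x ∷ xs)
      ≡⟨ count-split T? x~? (x ∷ xs) ⟨
    count T? (x ∷ xs) ∎
    where
    D : List B
    D = deduplicate R? (map g xs)
    T? : Decidable ((S ∘ g) ∩ Q)
    T? = (S? ∘ g) ∩? Q?
    x~? : Decidable (R (g x) ∘ g)
    x~? = R? (g x) ∘ g
    S′? : Decidable (S ∩ ∁ (R (g x)))
    S′? = S? ∩? ∁? (R? (g x))
    S′-resp : ∀ {b c} → R b c → (S ∩ ∁ (R (g x))) b → (S ∩ ∁ (R (g x))) c
    S′-resp b~c (Sb , ¬x~b) = S-resp b~c Sb , λ x~c → ¬x~b (R-trans x~c (R-sym b~c))
    classes′ : ClassCount (S ∩ ∁ (R (g x))) xs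
    classes′ {y} y∈xs (Sy , ¬x~y) = trans
      (sym (cong length (filter-reject (Q? ∩? (R? (g y) ∘ g)) (λ (_ , y~x) → ¬x~y (R-sym y~x)))))
      (classes (there y∈xs) Sy)
    other-classes : count (T? ∩? ∁? x~?) (x ∷ xs) ≡ count (S? ∩? P?) (filter (∁? (R? (g x))) D)
    other-classes = begin
      count (T? ∩? ∁? x~?) (x ∷ xs)
        ≡⟨ cong length (filter-reject (T? ∩? ∁? x~?) (λ (_ , ¬x~x) → ¬x~x R-refl)) ⟩
      count (T? ∩? ∁? x~?) xs
        ≡⟨ count-cong (T? ∩? ∁? x~?) ((S′? ∘ g) ∩? Q?) xs
             (λ _ ((s , q) , ¬r) → (s , ¬r) , q) (λ _ ((s , ¬r) , q) → (s , q) , ¬r) ⟩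
      count ((S′? ∘ g) ∩? Q?) xs
        ≡⟨ count-deduplicate-∩ S′? S′-resp xs classes′ ⟨
      count (S′? ∩? P?) D
        ≡⟨ count-cong (S′? ∩? P?) (∁? (R? (g x)) ∩? (S? ∩? P?)) D
             (λ _ ((s , ¬r) , p) → ¬r , s , p) (λ _ (¬r , s , p) → (s , ¬r) , p) ⟩
      count (∁? (R? (g x)) ∩? (S? ∩? P?)) D
        ≡⟨ count-filter (S? ∩? P?) (∁? (R? (g x))) D ⟨
      count (S? ∩? P?) (filter (∁? (R? (g x))) D) ∎
    class-of-x : count (T? ∩? x~?) (x ∷ xs) ≡ count (S? ∩? P?) [ g x ]
    class-of-x = by-cases (S? (g x))
      where
      by-cases : Dec (S (g x)) → count (T? ∩? x~?) (x ∷ xs) ≡ count (S? ∩? P?) [ g x ]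
      by-cases (yes Sx) = begin
        count (T? ∩? x~?) (x ∷ xs)
          ≡⟨ count-cong (T? ∩? x~?) (Q? ∩? x~?) (x ∷ xs)
               (λ _ ((_ , q) , r) → q , r) (λ _ (q , r) → (S-resp r Sx , q) , r) ⟩
        count (Q? ∩? x~?) (x ∷ xs)
          ≡⟨ classes (here refl) Sx ⟩
        count P? [ g x ]
          ≡⟨ count-cong P? (S? ∩? P?) [ g x ] (λ { (here refl) p → Sx , p }) (λ _ → proj₂) ⟩
        count (S? ∩? P?) [ g x ] ∎
      by-cases (no ¬Sx) = trans
        (count-none (T? ∩? x~?) (x ∷ xs) (All.tabulate λ _ ((Sy , _) , x~y) → ¬Sx (S-resp (R-sym x~y) Sy)))
        (sym (count-none (S? ∩? P?) [ g x ] ((λ (Sx , _) → ¬Sx Sx) ∷ [])))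

  count-deduplicate : (xs : List A) → ClassCount U xs → count P? (deduplicate R? (map g xs)) ≡ count Q? xs
  count-deduplicate xs classes = begin
    count P? (deduplicate R? (map g xs))
      ≡⟨ count-cong P? (U? ∩? P?) (deduplicate R? (map g xs)) (λ _ p → _ , p) (λ _ → proj₂) ⟩
    count (U? ∩? P?) (deduplicate R? (map g xs))
      ≡⟨ count-deduplicate-∩ U? _ xs classes ⟩
    count ((U? ∘ g) ∩? Q?) xs
      ≡⟨ count-cong ((U? ∘ g) ∩? Q?) Q? xs (λ _ → proj₂) (λ _ q → _ , q) ⟩
    count Q? xs ∎

-- Odd parts

[1+2*m]%2≡1 : ∀ m → suc (2 * m) % 2 ≡ 1
[1+2*m]%2≡1 m = trans (cong (λ k → suc k % 2) (*-comm 2 m)) ([m+kn]%n≡m%n 1 m 2)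

odd⇒≡1+2* : ∀ {m} → m % 2 ≡ 1 → m ≡ suc (2 * (m / 2))
odd⇒≡1+2* {m} m-odd = begin
  m                 ≡⟨ m≡m%n+[m/n]*n m 2 ⟩
  m % 2 + m / 2 * 2 ≡⟨ cong (_+ m / 2 * 2) m-odd ⟩
  suc (m / 2 * 2)   ≡⟨ cong suc (*-comm (m / 2) 2) ⟩
  suc (2 * (m / 2)) ∎

odd⇒coprime-2 : ∀ {q} → q % 2 ≡ 1 → Coprime q 2
odd⇒coprime-2 {q} q-odd (d∣q , d∣2) with ∣⇒≤ d∣2
... | z≤n             = contradiction (0∣⇒≡0 d∣2) λ ()
... | s≤s z≤n         = refl
... | s≤s (s≤s z≤n)   = contradiction (trans (sym q-odd) (n∣m⇒m%n≡0 q 2 d∣q)) λ ()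

odd∣2*⇒∣ : ∀ {q m} → q % 2 ≡ 1 → q ∣ 2 * m → q ∣ m
odd∣2*⇒∣ q-odd = coprime-divisor (odd⇒coprime-2 q-odd)

odd∣2^*⇒∣ : ∀ {q} v {m} → q % 2 ≡ 1 → q ∣ 2 ^ v * m → q ∣ m
odd∣2^*⇒∣ {q} zero    {m} _     q∣m  = subst (q ∣_) (+-identityʳ m) q∣m
odd∣2^*⇒∣ {q} (suc v) {m} q-odd q∣2m =
  odd∣2^*⇒∣ v q-odd (odd∣2*⇒∣ q-odd (subst (q ∣_) (*-assoc 2 (2 ^ v) m) q∣2m))

∣odd⇒odd : ∀ {q m} → m % 2 ≡ 1 → q ∣ m → q % 2 ≡ 1
∣odd⇒odd {q} m-odd q∣m with q % 2 in q%2 | m%n<n q 2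
... | 1           | _             = refl
... | 0           | _             =
  contradiction (trans (sym m-odd) (n∣m⇒m%n≡0 _ 2 (∣-trans (m%n≡0⇒n∣m q 2 q%2) q∣m))) λ ()
... | suc (suc _) | s≤s (s≤s ())

2^a∣2^b* : ∀ {a b} m → a ≤ b → 2 ^ a ∣ 2 ^ b * m
2^a∣2^b* {a} {b} m a≤b = ∣-trans (subst (2 ^ a ∣_) 2^a*2^[b∸a]≡2^b (m∣m*n (2 ^ (b ∸ a)))) (m∣m*n m)
  where
  2^a*2^[b∸a]≡2^b : 2 ^ a * 2 ^ (b ∸ a) ≡ 2 ^ b
  2^a*2^[b∸a]≡2^b = trans (sym (^-distribˡ-+-* 2 a (b ∸ a))) (cong (2 ^_) (m+[n∸m]≡n a≤b))

2^a∣2^b*odd⇒a≤b : ∀ a b m → 2 ^ a ∣ 2 ^ b * suc (2 * m) → a ≤ b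
2^a∣2^b*odd⇒a≤b zero    b       m _ = z≤n
2^a∣2^b*odd⇒a≤b (suc a) zero    m 2^a∣odd with ∣-trans (m∣m*n (2 ^ a)) 2^a∣odd
... | divides q eq = contradiction (trans (*-comm 2 q) (trans (sym eq) (+-identityʳ _))) (even≢odd q m)
2^a∣2^b*odd⇒a≤b (suc a) (suc b) m 2^a∣odd =
  s≤s (2^a∣2^b*odd⇒a≤b a b m (*-cancelˡ-∣ 2 (subst (2 ^ suc a ∣_) (*-assoc 2 (2 ^ b) (suc (2 * m))) 2^a∣odd)))

odd-part-unique : ∀ a b x y → 2 ^ a * suc (2 * x) ≡ 2 ^ b * suc (2 * y) → a ≡ b × x ≡ y
odd-part-unique a b x y eq = a≡b , x≡y
  where
  a≡b : a ≡ b
  a≡b = ≤-antisym (2^a∣2^b*odd⇒a≤b a b y (subst (2 ^ a ∣_) eq (m∣m*n (suc (2 * x)))))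
                  (2^a∣2^b*odd⇒a≤b b a x (subst (2 ^ b ∣_) (sym eq) (m∣m*n (suc (2 * y)))))
  x≡y : x ≡ y
  x≡y = *-cancelˡ-≡ x y 2 (suc-injective
    (*-cancelˡ-≡ _ _ (2 ^ a) {{m^n≢0 2 a}} (trans eq (cong (λ k → 2 ^ k * _) (sym a≡b)))))

ν₂-fuel-odd-part : ∀ f k → k ≤ f → 0 < k → ∃[ h ] k ≡ 2 ^ ν₂-fuel f k * suc (2 * h)
ν₂-fuel-odd-part (suc f) (suc k) k≤f _ with suc k % 2 in k%2
... | zero  = let (h , half≡) = ν₂-fuel-odd-part f half half≤f half>0 in h , (begin
  suc k                                  ≡⟨ k≡2*half ⟩
  2 * half                               ≡⟨ cong (2 *_) half≡ ⟩
  2 * (2 ^ ν₂-fuel f half * suc (2 * h)) ≡⟨ *-assoc 2 (2 ^ ν₂-fuel f half) (suc (2 * h)) ⟨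
  2 ^ suc (ν₂-fuel f half) * suc (2 * h) ∎)
  where
  half : ℕ
  half = suc k / 2
  k≡2*half : suc k ≡ 2 * half
  k≡2*half = trans (m≡m%n+[m/n]*n (suc k) 2) (trans (cong (_+ half * 2) k%2) (*-comm half 2))
  half≤f : half ≤ f
  half≤f = s≤s⁻¹ (≤-trans (m/n<m (suc k) 2 (s≤s (s≤s z≤n))) k≤f)
  half>0 : 0 < half
  half>0 = n≢0⇒n>0 λ half≡0 → contradiction (trans k≡2*half (cong (2 *_) half≡0)) λ ()
... | suc _ = suc k / 2 , trans (odd⇒≡1+2* k-odd) (sym (+-identityʳ _))
  where
  k-odd : suc k % 2 ≡ 1
  k-odd = trans k%2 (cong suc (n<1⇒n≡0 (s≤s⁻¹ (subst (_< 2) k%2 (m%n<n (suc k) 2)))))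

ν₂-odd-part : ∀ n → ∃[ k ] suc n ≡ 2 ^ ν₂-fuel (suc n) (suc n) * suc (2 * k)
ν₂-odd-part n = ν₂-fuel-odd-part (suc n) (suc n) ≤-refl (s≤s z≤n)

odd-part-half : ∀ {x} v k .{{_ : NonZero (2 ^ v)}} → x ≡ 2 ^ v * suc (2 * k) → (x / 2 ^ v ∸ 1) / 2 ≡ k
odd-part-half v k refl = begin
  (2 ^ v * suc (2 * k) / 2 ^ v ∸ 1) / 2 ≡⟨ cong (λ m → (m / 2 ^ v ∸ 1) / 2) (*-comm (2 ^ v) (suc (2 * k))) ⟩
  (suc (2 * k) * 2 ^ v / 2 ^ v ∸ 1) / 2 ≡⟨ cong (λ m → (m ∸ 1) / 2) (m*n/n≡m (suc (2 * k)) (2 ^ v)) ⟩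
  2 * k / 2                             ≡⟨ cong (_/ 2) (*-comm 2 k) ⟩
  k * 2 / 2                             ≡⟨ m*n/n≡m k 2 ⟩
  k                                     ∎

-- Rotations and the flip

-- List versions of rot and flipC: identities involving _++_ are proved on lists and
-- transferred along toList.
module _ {A : Set} where

  rotL : List A → List A
  rotL []       = []
  rotL (x ∷ xs) = xs ++ [ x ]

  rotL^ : ℕ → List A → List A
  rotL^ zero    xs = xs
  rotL^ (suc i) xs = rotL (rotL^ i xs)

  flipL : List A → List A
  flipL []       = []
  flipL (x ∷ xs) = x ∷ reverse xs

  rotL^-+ : ∀ a b (xs : List A) → rotL^ (a + b) xs ≡ rotL^ a (rotL^ b xs)
  rotL^-+ zero    b xs = refl
  rotL^-+ (suc a) b xs = cong rotL (rotL^-+ a b xs)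

  rotL^-sucʳ : ∀ i (xs : List A) → rotL^ i (rotL xs) ≡ rotL^ (suc i) xs
  rotL^-sucʳ i xs = trans (sym (rotL^-+ i 1 xs)) (cong (λ k → rotL^ k xs) (+-comm i 1))

  rotL^-length-++ : ∀ (xs ys : List A) → rotL^ (length xs) (xs ++ ys) ≡ ys ++ xs
  rotL^-length-++ []       ys = sym (List.++-identityʳ ys)
  rotL^-length-++ (x ∷ xs) ys = begin
    rotL^ (suc (length xs)) (x ∷ xs ++ ys) ≡⟨ rotL^-sucʳ (length xs) (x ∷ xs ++ ys) ⟨
    rotL^ (length xs) ((xs ++ ys) ++ [ x ]) ≡⟨ cong (rotL^ (length xs)) (List.++-assoc xs ys [ x ]) ⟩
    rotL^ (length xs) (xs ++ ys ++ [ x ])   ≡⟨ rotL^-length-++ xs (ys ++ [ x ]) ⟩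
    (ys ++ [ x ]) ++ xs                     ≡⟨ List.++-assoc ys [ x ] xs ⟩
    ys ++ x ∷ xs                            ∎

  rotL^-length : ∀ (xs : List A) → rotL^ (length xs) xs ≡ xs
  rotL^-length xs = trans (cong (rotL^ (length xs)) (sym (List.++-identityʳ xs))) (rotL^-length-++ xs [])

  length-flipL : ∀ (xs : List A) → length (flipL xs) ≡ length xs
  length-flipL []       = refl
  length-flipL (x ∷ xs) = cong suc (List.length-reverse xs)

  flipL-involutive : ∀ (xs : List A) → flipL (flipL xs) ≡ xs
  flipL-involutive []       = refl
  flipL-involutive (x ∷ xs) = cong (x ∷_) (List.reverse-involutive xs)

  rotL-flipL-rotL : ∀ (xs : List A) → rotL (flipL (rotL xs)) ≡ flipL xs
  rotL-flipL-rotL []           = refl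
  rotL-flipL-rotL (x ∷ [])     = refl
  rotL-flipL-rotL (x ∷ y ∷ xs) = begin
    reverse (xs ++ [ x ]) ++ [ y ] ≡⟨ cong (_++ [ y ]) (List.reverse-++ xs [ x ]) ⟩
    x ∷ reverse xs ++ [ y ]        ≡⟨ cong (x ∷_) (List.unfold-reverse y xs) ⟨
    x ∷ reverse (y ∷ xs)           ∎

bluesL : List Bool → ℕ
bluesL []          = 0
bluesL (true  ∷ c) = suc (bluesL c)
bluesL (false ∷ c) = bluesL c

bluesL-++ : ∀ xs ys → bluesL (xs ++ ys) ≡ bluesL xs + bluesL ys
bluesL-++ []           ys = refl
bluesL-++ (true  ∷ xs) ys = cong suc (bluesL-++ xs ys)
bluesL-++ (false ∷ xs) ys = bluesL-++ xs ys

bluesL-rotL : ∀ xs → bluesL (rotL xs) ≡ bluesL xs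
bluesL-rotL []       = refl
bluesL-rotL (x ∷ xs) = begin
  bluesL (xs ++ [ x ])      ≡⟨ bluesL-++ xs [ x ] ⟩
  bluesL xs + bluesL [ x ]  ≡⟨ +-comm (bluesL xs) (bluesL [ x ]) ⟩
  bluesL [ x ] + bluesL xs  ≡⟨ bluesL-++ [ x ] xs ⟨
  bluesL (x ∷ xs)           ∎

toList-injective : {c d : Coloring n} → toList c ≡ toList d → c ≡ d
toList-injective {c = c} eq = trans (sym (Vec.cast-is-id refl c)) (Vec.toList-injective refl c _ eq)

toList-rot : (c : Coloring n) → toList (rot c) ≡ rotL (toList c)
toList-rot []      = refl
toList-rot (x ∷ c) = Vec.toList-∷ʳ x c

toList-rot^ : ∀ i (c : Coloring n) → toList (rot^ i c) ≡ rotL^ i (toList c)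
toList-rot^ zero    c = refl
toList-rot^ (suc i) c = trans (toList-rot (rot^ i c)) (cong rotL (toList-rot^ i c))

toList-flipC : (c : Coloring n) → toList (flipC c) ≡ flipL (toList c)
toList-flipC []      = refl
toList-flipC (x ∷ c) = cong (x ∷_) (Vec.toList-reverse c)

blues≡bluesL∘toList : (c : Coloring n) → blues c ≡ bluesL (toList c)
blues≡bluesL∘toList []          = refl
blues≡bluesL∘toList (true  ∷ c) = cong suc (blues≡bluesL∘toList c)
blues≡bluesL∘toList (false ∷ c) = blues≡bluesL∘toList c

blues-rot^ : ∀ i (c : Coloring n) → blues (rot^ i c) ≡ blues c
blues-rot^ zero    c = refl
blues-rot^ (suc i) c = begin
  blues (rot (rot^ i c))            ≡⟨ blues≡bluesL∘toList (rot (rot^ i c)) ⟩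
  bluesL (toList (rot (rot^ i c)))  ≡⟨ cong bluesL (toList-rot (rot^ i c)) ⟩
  bluesL (rotL (toList (rot^ i c))) ≡⟨ bluesL-rotL (toList (rot^ i c)) ⟩
  bluesL (toList (rot^ i c))        ≡⟨ blues≡bluesL∘toList (rot^ i c) ⟨
  blues (rot^ i c)                  ≡⟨ blues-rot^ i c ⟩
  blues c                           ∎

rot^-+ : ∀ a b (c : Coloring n) → rot^ (a + b) c ≡ rot^ a (rot^ b c)
rot^-+ zero    b c = refl
rot^-+ (suc a) b c = cong rot (rot^-+ a b c)

rot^-comm : ∀ a b (c : Coloring n) → rot^ a (rot^ b c) ≡ rot^ b (rot^ a c)
rot^-comm a b c = trans (sym (rot^-+ a b c)) (trans (cong (λ k → rot^ k c) (+-comm a b)) (rot^-+ b a c))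

rot^-sucʳ : ∀ i (c : Coloring n) → rot^ i (rot c) ≡ rot^ (suc i) c
rot^-sucʳ i c = rot^-comm i 1 c

rot^-length : (c : Coloring n) → rot^ n c ≡ c
rot^-length {n} c = toList-injective (begin
  toList (rot^ n c)                    ≡⟨ toList-rot^ n c ⟩
  rotL^ n (toList c)                   ≡⟨ cong (λ k → rotL^ k (toList c)) (Vec.length-toList c) ⟨
  rotL^ (length (toList c)) (toList c) ≡⟨ rotL^-length (toList c) ⟩
  toList c                             ∎)

rot^-*length : ∀ k (c : Coloring n) → rot^ (k * n) c ≡ c
rot^-*length zero    c = refl
rot^-*length {n} (suc k) c = trans (rot^-+ n (k * n) c) (trans (cong (rot^ n) (rot^-*length k c)) (rot^-length c))

rot-injective : {c d : Coloring n} → rot c ≡ rot d → c ≡ d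
rot-injective {zero}  {[]} {[]} _ = refl
rot-injective {suc m} {c}  {d}  eq = begin
  c              ≡⟨ rot^-length c ⟨
  rot^ (suc m) c ≡⟨ rot^-sucʳ m c ⟨
  rot^ m (rot c) ≡⟨ cong (rot^ m) eq ⟩
  rot^ m (rot d) ≡⟨ rot^-sucʳ m d ⟩
  rot^ (suc m) d ≡⟨ rot^-length d ⟩
  d              ∎

rot^-injective : ∀ i {c d : Coloring n} → rot^ i c ≡ rot^ i d → c ≡ d
rot^-injective zero    eq = eq
rot^-injective (suc i) eq = rot^-injective i (rot-injective eq)

flipC-involutive : (c : Coloring n) → flipC (flipC c) ≡ c
flipC-involutive c = toList-injective (begin
  toList (flipC (flipC c)) ≡⟨ toList-flipC (flipC c) ⟩
  flipL (toList (flipC c)) ≡⟨ cong flipL (toList-flipC c) ⟩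
  flipL (flipL (toList c)) ≡⟨ flipL-involutive (toList c) ⟩
  toList c                 ∎)

rot-flipC-rot : (c : Coloring n) → rot (flipC (rot c)) ≡ flipC c
rot-flipC-rot c = toList-injective (begin
  toList (rot (flipC (rot c)))   ≡⟨ toList-rot (flipC (rot c)) ⟩
  rotL (toList (flipC (rot c)))  ≡⟨ cong rotL (toList-flipC (rot c)) ⟩
  rotL (flipL (toList (rot c)))  ≡⟨ cong (rotL ∘ flipL) (toList-rot c) ⟩
  rotL (flipL (rotL (toList c))) ≡⟨ rotL-flipL-rotL (toList c) ⟩
  flipL (toList c)               ≡⟨ toList-flipC c ⟨
  toList (flipC c)               ∎)

rot^-flipC-rot^ : ∀ i (c : Coloring n) → rot^ i (flipC (rot^ i c)) ≡ flipC c
rot^-flipC-rot^ zero    c = refl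
rot^-flipC-rot^ (suc i) c = begin
  rot (rot^ i (flipC (rot (rot^ i c)))) ≡⟨ rot^-sucʳ i _ ⟨
  rot^ i (rot (flipC (rot (rot^ i c)))) ≡⟨ cong (rot^ i) (rot-flipC-rot (rot^ i c)) ⟩
  rot^ i (flipC (rot^ i c))             ≡⟨ rot^-flipC-rot^ i c ⟩
  flipC c                               ∎

-- Periods and orbits

least-witness : {P : Pred ℕ 0ℓ} → Decidable P → ∀ k → P k → ∃[ m ] P m × (∀ {i} → i < m → ¬ P i)
least-witness P? zero    Pk = 0 , Pk , λ ()
least-witness P? (suc k) Pk with P? 0
... | yes P0 = 0 , P0 , λ ()
... | no ¬P0 with m , Pm , below ← least-witness (λ i → P? (suc i)) k Pk =
  suc m , Pm , λ { {zero} _ → ¬P0 ; {suc i} i<m → below (s≤s⁻¹ i<m) }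

rot^-inverse : ∀ i (c : Coloring (suc n)) → rot^ (i * n) (rot^ i c) ≡ c
rot^-inverse {n} i c = begin
  rot^ (i * n) (rot^ i c) ≡⟨ rot^-+ (i * n) i c ⟨
  rot^ (i * n + i) c      ≡⟨ cong (λ k → rot^ k c) (trans (+-comm (i * n) i) (sym (*-suc i n))) ⟩
  rot^ (i * suc n) c      ≡⟨ rot^-*length i c ⟩
  c                       ∎

flipC-fixed⇒rot^[i+i]≡flipC : ∀ i (c : Coloring n) → flipC (rot^ i c) ≡ rot^ i c → rot^ (i + i) c ≡ flipC c
flipC-fixed⇒rot^[i+i]≡flipC i c fixed = begin
  rot^ (i + i) c            ≡⟨ rot^-+ i i c ⟩
  rot^ i (rot^ i c)         ≡⟨ cong (rot^ i) fixed ⟨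
  rot^ i (flipC (rot^ i c)) ≡⟨ rot^-flipC-rot^ i c ⟩
  flipC c                   ∎

rot^[i+i]≡flipC⇒flipC-fixed : ∀ i (c : Coloring n) → rot^ (i + i) c ≡ flipC c → flipC (rot^ i c) ≡ rot^ i c
rot^[i+i]≡flipC⇒flipC-fixed i c rot^[i+i]≡ = rot^-injective i (begin
  rot^ i (flipC (rot^ i c)) ≡⟨ rot^-flipC-rot^ i c ⟩
  flipC c                   ≡⟨ rot^[i+i]≡ ⟨
  rot^ (i + i) c            ≡⟨ rot^-+ i i c ⟩
  rot^ i (rot^ i c)         ∎)

module Orbit (c : Coloring (suc n)) where

  private
    least-period : ∃[ m ] rot^ (suc m) c ≡ c × (∀ {i} → i < m → rot^ (suc i) c ≢ c)
    least-period = least-witness (λ i → rot^ (suc i) c ≟c c) n (rot^-length c)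

  period : ℕ
  period = suc (proj₁ least-period)

  rot^-period : rot^ period c ≡ c
  rot^-period = proj₁ (proj₂ least-period)

  rot^-period-minimal : ∀ {i} → 0 < i → i < period → rot^ i c ≢ c
  rot^-period-minimal {suc i} _ i<p = proj₂ (proj₂ least-period) (s≤s⁻¹ i<p)

  rot^-*period : ∀ k → rot^ (k * period) c ≡ c
  rot^-*period zero    = refl
  rot^-*period (suc k) = trans (rot^-+ period (k * period) c) (trans (cong (rot^ period) (rot^-*period k)) rot^-period)

  rot^-%period : ∀ a → rot^ a c ≡ rot^ (a % period) c
  rot^-%period a = begin
    rot^ a c                                        ≡⟨ cong (λ k → rot^ k c) (m≡m%n+[m/n]*n a period) ⟩
    rot^ (a % period + a / period * period) c       ≡⟨ rot^-+ (a % period) (a / period * period) c ⟩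
    rot^ (a % period) (rot^ (a / period * period) c) ≡⟨ cong (rot^ (a % period)) (rot^-*period (a / period)) ⟩
    rot^ (a % period) c                             ∎

  private
    rot^-<-distinct : ∀ {a b} → a < b → b < period → rot^ a c ≢ rot^ b c
    rot^-<-distinct {a} {b} a<b b<p eq = rot^-period-minimal (m<n⇒0<n∸m a<b) (≤-<-trans (m∸n≤m b a) b<p)
      (rot^-injective a (begin
        rot^ a (rot^ (b ∸ a) c) ≡⟨ rot^-+ a (b ∸ a) c ⟨
        rot^ (a + (b ∸ a)) c    ≡⟨ cong (λ k → rot^ k c) (m+[n∸m]≡n (<⇒≤ a<b)) ⟩
        rot^ b c                ≡⟨ eq ⟨
        rot^ a c                ∎))

  rot^-injective-<period : ∀ {a b} → a < period → b < period → rot^ a c ≡ rot^ b c → a ≡ b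
  rot^-injective-<period {a} {b} a<p b<p eq with <-cmp a b
  ... | tri< a<b _ _ = contradiction eq (rot^-<-distinct a<b b<p)
  ... | tri≈ _ a≡b _ = a≡b
  ... | tri> _ _ b<a = contradiction (sym eq) (rot^-<-distinct b<a a<p)

  rot^-fixed⇒period∣ : ∀ a → rot^ a c ≡ c → period ∣ a
  rot^-fixed⇒period∣ a fixed = m%n≡0⇒n∣m a period
    (rot^-injective-<period (m%n<n a period) (s≤s z≤n) (trans (sym (rot^-%period a)) fixed))

  period∣⇒rot^-fixed : ∀ {a} → period ∣ a → rot^ a c ≡ c
  period∣⇒rot^-fixed (divides k refl) = rot^-*period k

  period∣n : period ∣ suc n
  period∣n = rot^-fixed⇒period∣ (suc n) (rot^-length c)

  rot^∈orbit : ∀ i → rot^ i c ∈ orbit c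
  rot^∈orbit i = subst (_∈ orbit c) (sym (rot^-%period i))
    (∈-deduplicate⁺ _≟c_ (∈-map⁺ (λ i → rot^ i c) (∈-upTo⁺ (<-≤-trans (m%n<n i period) (∣⇒≤ period∣n)))))

  ∈orbit⇒rot^ : ∀ {d} → d ∈ orbit c → ∃[ i ] i < period × d ≡ rot^ i c
  ∈orbit⇒rot^ d∈
    with i , _ , refl ← ∈-map⁻ (λ i → rot^ i c) {xs = upTo (suc n)}
                          (∈-deduplicate⁻ _≟c_ (map (λ i → rot^ i c) (upTo (suc n))) d∈)
    = i % period , m%n<n i period , rot^-%period i

  orbit-unique : Unique (orbit c)
  orbit-unique = deduplicate-! _≟c_ (map (λ i → rot^ i c) (upTo (suc n)))

  length-orbit : length (orbit c) ≡ period
  length-orbit = ≤-antisym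
    (subst (length (orbit c) ≤_) (length-applyUpTo (λ i → rot^ i c) period)
      (Unique-⊆⇒length-≤ orbit-unique orbit⊆first-period))
    (subst (_≤ length (orbit c)) (length-applyUpTo (λ i → rot^ i c) period)
      (Unique-⊆⇒length-≤ first-period-unique first-period⊆orbit))
    where
    open WithDecidableEquality _≟c_
    first-period : List (Coloring (suc n))
    first-period = applyUpTo (λ i → rot^ i c) period
    first-period-unique : Unique first-period
    first-period-unique = Unique.applyUpTo⁺₁ (λ i → rot^ i c) period
      (λ i<j j<p eq → <⇒≢ i<j (rot^-injective-<period (<-trans i<j j<p) j<p eq))
    orbit⊆first-period : ∀ {d} → d ∈ orbit c → d ∈ first-period
    orbit⊆first-period d∈ with i , i<p , refl ← ∈orbit⇒rot^ d∈ = ∈-applyUpTo⁺ (λ i → rot^ i c) i<p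
    first-period⊆orbit : ∀ {d} → d ∈ first-period → d ∈ orbit c
    first-period⊆orbit d∈ with i , _ , refl ← ∈-applyUpTo⁻ (λ i → rot^ i c) d∈ = rot^∈orbit i

  flipC∈orbit⇒FixedByFlip : flipC c ∈ orbit c → FixedByFlip (orbit c)
  flipC∈orbit⇒FixedByFlip flipc∈ = All.tabulate flip∈ , All.tabulate flip⁻¹∈
    where
    flipC-closed : ∀ {d} → d ∈ orbit c → flipC d ∈ orbit c
    flipC-closed d∈ with i , _ , refl ← ∈orbit⇒rot^ d∈ | k , _ , flipc≡ ← ∈orbit⇒rot^ flipc∈ =
      subst (_∈ orbit c) (begin
        rot^ (i * n + k) c                       ≡⟨ rot^-+ (i * n) k c ⟩
        rot^ (i * n) (rot^ k c)                  ≡⟨ cong (rot^ (i * n)) flipc≡ ⟨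
        rot^ (i * n) (flipC c)                   ≡⟨ cong (rot^ (i * n)) (rot^-flipC-rot^ i c) ⟨
        rot^ (i * n) (rot^ i (flipC (rot^ i c))) ≡⟨ rot^-inverse i (flipC (rot^ i c)) ⟩
        flipC (rot^ i c)                         ∎) (rot^∈orbit (i * n + k))
    flip∈ : ∀ {d} → d ∈ map flipC (orbit c) → d ∈ orbit c
    flip∈ d∈ with d , d∈ , refl ← ∈-map⁻ flipC d∈ = flipC-closed d∈
    flip⁻¹∈ : ∀ {d} → d ∈ orbit c → d ∈ map flipC (orbit c)
    flip⁻¹∈ {d} d∈ = subst (_∈ map flipC (orbit c)) (flipC-involutive d) (∈-map⁺ flipC (flipC-closed d∈))

  FixedByFlip⇒flipC∈orbit : FixedByFlip (orbit c) → flipC c ∈ orbit c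
  FixedByFlip⇒flipC∈orbit (flip⊆ , _) = All.lookup flip⊆ (∈-map⁺ flipC (rot^∈orbit 0))

  module _ (period-odd : period % 2 ≡ 1) where

    -- With flipC c = rot^ k c and period 2q+1, i = k(q+1) solves 2i ≡ k modulo the period.
    flipC∈orbit⇒∃flipC-fixed : flipC c ∈ orbit c → ∃[ i ] flipC (rot^ i c) ≡ rot^ i c
    flipC∈orbit⇒∃flipC-fixed flipc∈ with k , _ , flipc≡ ← ∈orbit⇒rot^ flipc∈ =
      i , rot^[i+i]≡flipC⇒flipC-fixed i c (begin
        rot^ (i + i) c               ≡⟨ cong (λ a → rot^ a c) (i+i≡k+k*p k q) ⟩
        rot^ (k + k * suc (2 * q)) c ≡⟨ cong (λ a → rot^ (k + k * a) c) p≡1+2q ⟨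
        rot^ (k + k * period) c      ≡⟨ rot^-+ k (k * period) c ⟩
        rot^ k (rot^ (k * period) c) ≡⟨ cong (rot^ k) (rot^-*period k) ⟩
        rot^ k c                     ≡⟨ flipc≡ ⟨
        flipC c                      ∎)
      where
      q : ℕ
      q = period / 2
      p≡1+2q : period ≡ suc (2 * q)
      p≡1+2q = odd⇒≡1+2* period-odd
      i : ℕ
      i = k * suc q
      i+i≡k+k*p : ∀ k q → k * suc q + k * suc q ≡ k + k * suc (2 * q)
      i+i≡k+k*p = solve-∀

    -- Two flip-fixed colorings of the orbit differ by a rotation d with rot^ (d + d) trivial,
    -- so the period divides d + d and, being odd, d.
    flipC-fixed-unique : ∀ a b → flipC (rot^ a c) ≡ rot^ a c → flipC (rot^ b c) ≡ rot^ b c → rot^ a c ≡ rot^ b c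
    flipC-fixed-unique a b x-fixed y-fixed = begin
      rot^ a c          ≡⟨ x≡rot^d[y] ⟩
      rot^ d (rot^ b c) ≡⟨ rot^-comm d b c ⟩
      rot^ b (rot^ d c) ≡⟨ cong (rot^ b) (period∣⇒rot^-fixed p∣d) ⟩
      rot^ b c          ∎
      where
      d : ℕ
      d = a + b * n
      x≡rot^d[y] : rot^ a c ≡ rot^ d (rot^ b c)
      x≡rot^d[y] = sym (trans (rot^-+ a (b * n) (rot^ b c)) (cong (rot^ a) (rot^-inverse b c)))
      rot^[d+d]c≡c : rot^ (d + d) c ≡ c
      rot^[d+d]c≡c = rot^-injective b (begin
        rot^ b (rot^ (d + d) c) ≡⟨ rot^-comm b (d + d) c ⟩
        rot^ (d + d) (rot^ b c)
          ≡⟨ flipC-fixed⇒rot^[i+i]≡flipC d (rot^ b c) (subst (λ x → flipC x ≡ x) x≡rot^d[y] x-fixed) ⟩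
        flipC (rot^ b c)        ≡⟨ y-fixed ⟩
        rot^ b c                ∎)
      p∣d : period ∣ d
      p∣d = odd∣2*⇒∣ period-odd
        (subst (period ∣_) (cong (d +_) (sym (+-identityʳ d))) (rot^-fixed⇒period∣ (d + d) rot^[d+d]c≡c))

-- Orbits of odd size fixed by the flip

allColorings-unique : ∀ n → Unique (allColorings n)
allColorings-unique zero    = [] ∷ []
allColorings-unique (suc n) = Unique.++⁺ (Unique.map⁺ Vec.∷-injectiveʳ (allColorings-unique n))
  (Unique.map⁺ Vec.∷-injectiveʳ (allColorings-unique n)) heads-differ
  where
  heads-differ : ∀ {c} → ¬ (c ∈ map (true ∷_) (allColorings n) × c ∈ map (false ∷_) (allColorings n))
  heads-differ (c∈ , c∈′) with _ , _ , refl ← ∈-map⁻ (true ∷_) c∈ | _ , _ , () ← ∈-map⁻ (false ∷_) c∈′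

∈allColorings : (c : Coloring n) → c ∈ allColorings n
∈allColorings []          = here refl
∈allColorings (true  ∷ c) = ∈-++⁺ˡ (∈-map⁺ (true ∷_) (∈allColorings c))
∈allColorings {suc n} (false ∷ c) = ∈-++⁺ʳ (map (true ∷_) (allColorings n)) (∈-map⁺ (false ∷_) (∈allColorings c))

Neck-unique : ∀ n j → Unique (Neck n j)
Neck-unique n j = Unique.filter⁺ (λ c → blues c ≟ j) (allColorings-unique n)

SameSet-isEquivalence : IsEquivalence (SameSet {n})
SameSet-isEquivalence = record
  { refl  = All.tabulate id , All.tabulate id
  ; sym   = λ (xs⊆ys , ys⊆xs) → ys⊆xs , xs⊆ys
  ; trans = λ (xs⊆ys , ys⊆xs) (ys⊆zs , zs⊆ys) → All.map (All.lookup ys⊆zs) xs⊆ys , All.map (All.lookup ys⊆xs) zs⊆ys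
  }

∈orbit⇒SameSet : (c d : Coloring (suc n)) → d ∈ orbit c → SameSet (orbit c) (orbit d)
∈orbit⇒SameSet {n} c d d∈ with k , _ , refl ← Orbit.∈orbit⇒rot^ c d∈ = All.tabulate ⊆orbit-d , All.tabulate ⊆orbit-c
  where
  ⊆orbit-d : ∀ {x} → x ∈ orbit c → x ∈ orbit (rot^ k c)
  ⊆orbit-d x∈ with i , _ , refl ← Orbit.∈orbit⇒rot^ c x∈ =
    subst (_∈ orbit (rot^ k c)) (trans (rot^-+ i (k * n) (rot^ k c)) (cong (rot^ i) (rot^-inverse k c)))
      (Orbit.rot^∈orbit (rot^ k c) (i + k * n))
  ⊆orbit-c : ∀ {x} → x ∈ orbit (rot^ k c) → x ∈ orbit c
  ⊆orbit-c x∈ with i , _ , refl ← Orbit.∈orbit⇒rot^ (rot^ k c) x∈ =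
    subst (_∈ orbit c) (rot^-+ i k c) (Orbit.rot^∈orbit c (i + k))

SameSet⇒∈orbit : (c d : Coloring (suc n)) → SameSet (orbit c) (orbit d) → d ∈ orbit c
SameSet⇒∈orbit c d (_ , orbit-d⊆) = All.lookup orbit-d⊆ (Orbit.rot^∈orbit d 0)

FlipRotFixed : ℕ → Pred (Coloring n) 0ℓ
FlipRotFixed m d = flipC d ≡ d × rot^ m d ≡ d

flipRotFixed? : ∀ m → Decidable (FlipRotFixed {n} m)
flipRotFixed? m d = (flipC d ≟c d) ×-dec (rot^ m d ≟c d)

OddFlipFixed : Pred (List (Coloring n)) 0ℓ
OddFlipFixed O = OddCard O × FixedByFlip O

oddFlipFixed? : Decidable (OddFlipFixed {n})
oddFlipFixed? O = (length O % 2 ≟ 1) ×-dec sameSet? (map flipC O) O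

module _ {m : ℕ} (m-odd : m % 2 ≡ 1) (odd∣⇒∣m : ∀ {q} → q % 2 ≡ 1 → q ∣ suc n → q ∣ m) where

  count-FlipRotFixed-orbit-odd : (c : Coloring (suc n)) → OddFlipFixed (orbit c) →
                                 count (flipRotFixed? m) (orbit c) ≡ 1
  count-FlipRotFixed-orbit-odd c (odd , fixed) =
    count-≡1 (flipRotFixed? m) orbit-unique (rot^∈orbit i) (i-fixed , rot^-m-fixed) unique
    where
    open Orbit c
    open WithDecidableEquality _≟c_
    period-odd : period % 2 ≡ 1
    period-odd = subst (λ k → k % 2 ≡ 1) length-orbit odd
    i : ℕ
    i = proj₁ (flipC∈orbit⇒∃flipC-fixed period-odd (FixedByFlip⇒flipC∈orbit fixed))
    i-fixed : flipC (rot^ i c) ≡ rot^ i c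
    i-fixed = proj₂ (flipC∈orbit⇒∃flipC-fixed period-odd (FixedByFlip⇒flipC∈orbit fixed))
    rot^-m-fixed : rot^ m (rot^ i c) ≡ rot^ i c
    rot^-m-fixed = trans (rot^-comm m i c) (cong (rot^ i) (period∣⇒rot^-fixed (odd∣⇒∣m period-odd period∣n)))
    unique : ∀ {x} → x ∈ orbit c → FlipRotFixed m x → x ≡ rot^ i c
    unique x∈ (x-fixed , _) with a , _ , refl ← ∈orbit⇒rot^ x∈ = flipC-fixed-unique period-odd a i x-fixed i-fixed

  count-FlipRotFixed-orbit-¬odd : (c : Coloring (suc n)) → ¬ OddFlipFixed (orbit c) →
                                  count (flipRotFixed? m) (orbit c) ≡ 0
  count-FlipRotFixed-orbit-¬odd c ¬odd-fixed = count-none (flipRotFixed? m) (orbit c) (All.tabulate not-fixed)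
    where
    open Orbit c
    not-fixed : ∀ {x} → x ∈ orbit c → ¬ FlipRotFixed m x
    not-fixed x∈ (x-fixed , x-rot) with i , _ , refl ← ∈orbit⇒rot^ x∈ = ¬odd-fixed
      ( subst (λ k → k % 2 ≡ 1) (sym length-orbit)
          (∣odd⇒odd m-odd (rot^-fixed⇒period∣ m (rot^-injective i (trans (rot^-comm i m c) x-rot))))
      , flipC∈orbit⇒FixedByFlip (subst (_∈ orbit c) (flipC-fixed⇒rot^[i+i]≡flipC i c x-fixed) (rot^∈orbit (i + i))))

  count-FlipRotFixed-orbit : (c : Coloring (suc n)) → count (flipRotFixed? m) (orbit c) ≡ count oddFlipFixed? [ orbit c ]
  count-FlipRotFixed-orbit c with oddFlipFixed? (orbit c)
  ... | yes odd-fixed = trans (count-FlipRotFixed-orbit-odd c odd-fixed)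
                              (sym (cong length (filter-accept oddFlipFixed? odd-fixed)))
  ... | no ¬odd-fixed = trans (count-FlipRotFixed-orbit-¬odd c ¬odd-fixed)
                              (sym (cong length (filter-reject oddFlipFixed? ¬odd-fixed)))

  count-FlipRotFixed-class : ∀ j (c : Coloring (suc n)) → c ∈ Neck (suc n) j →
    count (flipRotFixed? m ∩? (sameSet? (orbit c) ∘ orbit)) (Neck (suc n) j) ≡ count oddFlipFixed? [ orbit c ]
  count-FlipRotFixed-class j c c∈ = trans
    (count-≡-by-inverses _≟c_ _≟c_ (flipRotFixed? m ∩? (sameSet? (orbit c) ∘ orbit)) (flipRotFixed? m) id id
      (Neck-unique (suc n) j) (Orbit.orbit-unique c)
      (λ _ (fixed , same) → SameSet⇒∈orbit c _ same , fixed)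
      (λ d∈ fixed → ∈Neck d∈ , fixed , ∈orbit⇒SameSet c _ d∈)
      (λ _ _ → refl) (λ _ _ → refl))
    (count-FlipRotFixed-orbit c)
    where
    ∈Neck : ∀ {d} → d ∈ orbit c → d ∈ Neck (suc n) j
    ∈Neck d∈ with i , _ , refl ← Orbit.∈orbit⇒rot^ c d∈ =
      ∈-filter⁺ (λ c → blues c ≟ j) (∈allColorings (rot^ i c))
      (trans (blues-rot^ i c) (proj₂ (∈-filter⁻ (λ c → blues c ≟ j) {xs = allColorings (suc n)} c∈)))

  length-OrbOddFixed≡count-FlipRotFixed : ∀ j →
    length (OrbOddFixed (suc n) j) ≡ count (flipRotFixed? m) (Neck (suc n) j)
  length-OrbOddFixed≡count-FlipRotFixed j = CountClasses.count-deduplicate orbit sameSet? SameSet-isEquivalence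
    oddFlipFixed? (flipRotFixed? m) (Neck (suc n) j) (λ c∈ _ → count-FlipRotFixed-class j _ c∈)

-- Repetitions and palindromes

module _ {A : Set} where

  take-length-++ : ∀ (xs ys : List A) → take (length xs) (xs ++ ys) ≡ xs
  take-length-++ []       ys = refl
  take-length-++ (x ∷ xs) ys = cong (x ∷_) (take-length-++ xs ys)

  take-≤-++ : ∀ k (xs ys : List A) → k ≤ length xs → take k (xs ++ ys) ≡ take k xs
  take-≤-++ zero    xs       ys _         = refl
  take-≤-++ (suc k) (x ∷ xs) ys (s≤s k≤) = cong (x ∷_) (take-≤-++ k xs ys k≤)

  length-take-≤ : ∀ k (xs : List A) → k ≤ length xs → length (take k xs) ≡ k
  length-take-≤ k xs k≤ = trans (List.length-take k xs) (m≤n⇒m⊓n≡m k≤)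

  repeat : ℕ → List A → List A
  repeat zero    w = []
  repeat (suc t) w = w ++ repeat t w

  length-repeat : ∀ t (w : List A) → length (repeat t w) ≡ t * length w
  length-repeat zero    w = refl
  length-repeat (suc t) w = trans (List.length-++ w) (cong (length w +_) (length-repeat t w))

  repeat-++-comm : ∀ t (w : List A) → repeat t w ++ w ≡ w ++ repeat t w
  repeat-++-comm zero    w = sym (List.++-identityʳ w)
  repeat-++-comm (suc t) w = trans (List.++-assoc w (repeat t w) w) (cong (w ++_) (repeat-++-comm t w))

  take-repeat : ∀ t (w : List A) → take (length w) (repeat (suc t) w) ≡ w
  take-repeat t w = take-length-++ w (repeat t w)

  rotL^-repeat : ∀ t (w : List A) → rotL^ (length w) (repeat t w) ≡ repeat t w
  rotL^-repeat zero    w = rotL^-[] (length w)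
    where
    rotL^-[] : ∀ k → rotL^ k [] ≡ []
    rotL^-[] zero    = refl
    rotL^-[] (suc k) = cong rotL (rotL^-[] k)
  rotL^-repeat (suc t) w = trans (rotL^-length-++ w (repeat t w)) (repeat-++-comm t w)

  reverse-repeat : ∀ t (w : List A) → reverse (repeat t w) ≡ repeat t (reverse w)
  reverse-repeat zero    w = refl
  reverse-repeat (suc t) w = begin
    reverse (w ++ repeat t w)           ≡⟨ List.reverse-++ w (repeat t w) ⟩
    reverse (repeat t w) ++ reverse w   ≡⟨ cong (_++ reverse w) (reverse-repeat t w) ⟩
    repeat t (reverse w) ++ reverse w   ≡⟨ repeat-++-comm t (reverse w) ⟩
    reverse w ++ repeat t (reverse w)   ∎

  flipL-repeat : ∀ t (w : List A) → flipL (repeat t w) ≡ repeat t (flipL w)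
  flipL-repeat zero    w        = refl
  flipL-repeat (suc t) []       = flipL-repeat t []
  flipL-repeat (suc t) (x ∷ w) = cong (x ∷_) (begin
    reverse (w ++ repeat t (x ∷ w))             ≡⟨ cong reverse (shift t) ⟩
    reverse (repeat t (w ++ [ x ]) ++ w)        ≡⟨ List.reverse-++ (repeat t (w ++ [ x ])) w ⟩
    reverse w ++ reverse (repeat t (w ++ [ x ])) ≡⟨ cong (reverse w ++_) (reverse-repeat t (w ++ [ x ])) ⟩
    reverse w ++ repeat t (reverse (w ++ [ x ])) ≡⟨ cong (λ u → reverse w ++ repeat t u) (List.reverse-++ w [ x ]) ⟩
    reverse w ++ repeat t (x ∷ reverse w)       ∎)
    where
    shift : ∀ t → w ++ repeat t (x ∷ w) ≡ repeat t (w ++ [ x ]) ++ w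
    shift zero    = List.++-identityʳ w
    shift (suc t) = begin
      w ++ x ∷ w ++ repeat t (x ∷ w)                ≡⟨ cong (λ u → w ++ x ∷ u) (shift t) ⟩
      w ++ x ∷ repeat t (w ++ [ x ]) ++ w           ≡⟨ List.++-assoc w [ x ] _ ⟨
      (w ++ [ x ]) ++ repeat t (w ++ [ x ]) ++ w    ≡⟨ List.++-assoc (w ++ [ x ]) _ w ⟨
      ((w ++ [ x ]) ++ repeat t (w ++ [ x ])) ++ w  ∎

  commuting⇒repeat : ∀ t (a b : List A) → length b ≡ t * length a → a ++ b ≡ b ++ a → b ≡ repeat t a
  commuting⇒repeat zero    a []  _  _ = refl
  commuting⇒repeat (suc t) a b |b| ab≡ba = trans b≡a++b′ (cong (a ++_) (commuting⇒repeat t a b′ |b′| ab′≡b′a))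
    where
    |a|≤|b| : length a ≤ length b
    |a|≤|b| = subst (length a ≤_) (sym |b|) (m≤m+n (length a) (t * length a))
    b′ : List A
    b′ = drop (length a) b
    take-b : take (length a) b ≡ a
    take-b = begin
      take (length a) b        ≡⟨ take-≤-++ (length a) b a |a|≤|b| ⟨
      take (length a) (b ++ a) ≡⟨ cong (take (length a)) ab≡ba ⟨
      take (length a) (a ++ b) ≡⟨ take-length-++ a b ⟩
      a                        ∎
    b≡a++b′ : b ≡ a ++ b′
    b≡a++b′ = trans (sym (List.take++drop≡id (length a) b)) (cong (_++ b′) take-b)
    |b′| : length b′ ≡ t * length a
    |b′| = trans (List.length-drop (length a) b) (trans (cong (_∸ length a) |b|) (m+n∸m≡n (length a) (t * length a)))
    ab′≡b′a : a ++ b′ ≡ b′ ++ a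
    ab′≡b′a = List.++-cancelˡ a (a ++ b′) (b′ ++ a) (begin
      a ++ a ++ b′   ≡⟨ cong (a ++_) b≡a++b′ ⟨
      a ++ b         ≡⟨ ab≡ba ⟩
      b ++ a         ≡⟨ cong (_++ a) b≡a++b′ ⟩
      (a ++ b′) ++ a ≡⟨ List.++-assoc a b′ a ⟩
      a ++ b′ ++ a   ∎)

  rotL^-fixed⇒repeat : ∀ t m (xs : List A) → length xs ≡ suc t * m → rotL^ m xs ≡ xs →
                       repeat (suc t) (take m xs) ≡ xs
  rotL^-fixed⇒repeat t m xs |xs| fixed = begin
    a ++ repeat t a ≡⟨ cong (a ++_) (commuting⇒repeat t a b |b| ab≡ba) ⟨
    a ++ b          ≡⟨ List.take++drop≡id m xs ⟩
    xs              ∎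
    where
    a : List A
    a = take m xs
    b : List A
    b = drop m xs
    |a| : length a ≡ m
    |a| = length-take-≤ m xs (subst (m ≤_) (sym |xs|) (m≤m+n m (t * m)))
    |b| : length b ≡ t * length a
    |b| = trans (List.length-drop m xs) (trans (cong (_∸ m) |xs|) (trans (m+n∸m≡n m (t * m)) (cong (t *_) (sym |a|))))
    ab≡ba : a ++ b ≡ b ++ a
    ab≡ba = begin
      a ++ b                   ≡⟨ List.take++drop≡id m xs ⟩
      xs                       ≡⟨ fixed ⟨
      rotL^ m xs               ≡⟨ cong (rotL^ m) (List.take++drop≡id m xs) ⟨
      rotL^ m (a ++ b)         ≡⟨ cong (λ k → rotL^ k (a ++ b)) |a| ⟨
      rotL^ (length a) (a ++ b) ≡⟨ rotL^-length-++ a b ⟩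
      b ++ a                   ∎

  mirror : List A → List A
  mirror []      = []
  mirror (x ∷ u) = x ∷ u ++ reverse u

  flipL-mirror : ∀ (y : List A) → flipL (mirror y) ≡ mirror y
  flipL-mirror []      = refl
  flipL-mirror (x ∷ u) = cong (x ∷_) (trans (List.reverse-++ u (reverse u)) (cong (_++ reverse u) (List.reverse-involutive u)))

  length-mirror : ∀ x (u : List A) → length (mirror (x ∷ u)) ≡ suc (2 * length u)
  length-mirror x u = cong suc (begin
    length (u ++ reverse u)             ≡⟨ List.length-++ u ⟩
    length u + length (reverse u)       ≡⟨ cong (length u +_) (List.length-reverse u) ⟩
    length u + length u                 ≡⟨ cong (length u +_) (+-identityʳ (length u)) ⟨
    2 * length u                        ∎)

  take-mirror : ∀ x (u : List A) → take (suc (length u)) (mirror (x ∷ u)) ≡ x ∷ u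
  take-mirror x u = cong (x ∷_) (take-length-++ u (reverse u))

  flipL-fixed⇒mirror : ∀ k (w : List A) → length w ≡ suc (2 * k) → flipL w ≡ w → mirror (take (suc k) w) ≡ w
  flipL-fixed⇒mirror k (x ∷ w) |xw| fixed = cong (x ∷_) (begin
    a ++ reverse a ≡⟨ cong (a ++_) reverse-a≡b ⟩
    a ++ b         ≡⟨ List.take++drop≡id k w ⟩
    w              ∎)
    where
    a : List A
    a = take k w
    b : List A
    b = drop k w
    |w| : length w ≡ k + k
    |w| = trans (suc-injective |xw|) (cong (k +_) (+-identityʳ k))
    |a| : length a ≡ k
    |a| = length-take-≤ k w (subst (k ≤_) (sym |w|) (m≤m+n k k))
    |rev-b| : length (reverse b) ≡ k
    |rev-b| = trans (List.length-reverse b) (trans (List.length-drop k w) (trans (cong (_∸ k) |w|) (m+n∸m≡n k k)))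
    reverse-w : reverse b ++ reverse a ≡ a ++ b
    reverse-w = begin
      reverse b ++ reverse a ≡⟨ List.reverse-++ a b ⟨
      reverse (a ++ b)       ≡⟨ cong reverse (List.take++drop≡id k w) ⟩
      reverse w              ≡⟨ List.∷-injectiveʳ fixed ⟩
      w                      ≡⟨ List.take++drop≡id k w ⟨
      a ++ b                 ∎
    reverse-b≡a : reverse b ≡ a
    reverse-b≡a = begin
      reverse b                                          ≡⟨ take-length-++ (reverse b) (reverse a) ⟨
      take (length (reverse b)) (reverse b ++ reverse a) ≡⟨ cong₂ take |rev-b| reverse-w ⟩
      take k (a ++ b)                                    ≡⟨ cong (λ i → take i (a ++ b)) |a| ⟨
      take (length a) (a ++ b)                           ≡⟨ take-length-++ a b ⟩
      a                                                  ∎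
    reverse-a≡b : reverse a ≡ b
    reverse-a≡b = trans (cong reverse (sym reverse-b≡a)) (List.reverse-involutive b)

-- Counting symmetric words

_≟L_ : DecidableEquality (List Bool)
_≟L_ = List.≡-dec Bool._≟_

allLists : ℕ → List (List Bool)
allLists n = map toList (allColorings n)

allLists-unique : ∀ n → Unique (allLists n)
allLists-unique n = Unique.map⁺ toList-injective (allColorings-unique n)

∈allLists : ∀ {n} xs → length xs ≡ n → xs ∈ allLists n
∈allLists xs refl = subst (_∈ allLists (length xs)) (Vec.toList∘fromList xs) (∈-map⁺ toList (∈allColorings (fromList xs)))

∈allLists⇒length : ∀ {n xs} → xs ∈ allLists n → length xs ≡ n
∈allLists⇒length xs∈ with c , _ , refl ← ∈-map⁻ toList xs∈ = Vec.length-toList c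

bluesL-reverse : ∀ xs → bluesL (reverse xs) ≡ bluesL xs
bluesL-reverse []       = refl
bluesL-reverse (x ∷ xs) = begin
  bluesL (reverse (x ∷ xs))          ≡⟨ cong bluesL (List.unfold-reverse x xs) ⟩
  bluesL (reverse xs ++ [ x ])       ≡⟨ bluesL-++ (reverse xs) [ x ] ⟩
  bluesL (reverse xs) + bluesL [ x ] ≡⟨ cong (_+ bluesL [ x ]) (bluesL-reverse xs) ⟩
  bluesL xs + bluesL [ x ]           ≡⟨ +-comm (bluesL xs) (bluesL [ x ]) ⟩
  bluesL [ x ] + bluesL xs           ≡⟨ bluesL-++ [ x ] xs ⟨
  bluesL (x ∷ xs)                    ∎

bluesL-repeat : ∀ t xs → bluesL (repeat t xs) ≡ t * bluesL xs
bluesL-repeat zero    xs = refl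
bluesL-repeat (suc t) xs = trans (bluesL-++ xs (repeat t xs)) (cong (bluesL xs +_) (bluesL-repeat t xs))

bluesL-++-reverse : ∀ xs → bluesL (xs ++ reverse xs) ≡ 2 * bluesL xs
bluesL-++-reverse xs = begin
  bluesL (xs ++ reverse xs)         ≡⟨ bluesL-++ xs (reverse xs) ⟩
  bluesL xs + bluesL (reverse xs)   ≡⟨ cong (bluesL xs +_) (trans (bluesL-reverse xs) (sym (+-identityʳ (bluesL xs)))) ⟩
  2 * bluesL xs                     ∎

fibreCount : ℕ → (ℕ → ℕ) → ℕ → ℕ
fibreCount k F j = count (λ u → F (blues u) ≟ j) (allColorings k)

BlueFlipRotFixed : (j m : ℕ) → Pred (List Bool) 0ℓ
BlueFlipRotFixed j m xs = bluesL xs ≡ j × flipL xs ≡ xs × rotL^ m xs ≡ xs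

blueFlipRotFixed? : ∀ j m → Decidable (BlueFlipRotFixed j m)
blueFlipRotFixed? j m xs = (bluesL xs ≟ j) ×-dec ((flipL xs ≟L xs) ×-dec (rotL^ m xs ≟L xs))

count-FlipRotFixed≡count-allLists : ∀ {N} m j →
  count (flipRotFixed? m) (Neck N j) ≡ count (blueFlipRotFixed? j m) (allLists N)
count-FlipRotFixed≡count-allLists {N} m j = begin
  count (flipRotFixed? m) (Neck N j)
    ≡⟨ count-filter (flipRotFixed? m) (λ c → blues c ≟ j) (allColorings N) ⟩
  count ((λ c → blues c ≟ j) ∩? flipRotFixed? m) (allColorings N)
    ≡⟨ count-cong _ (blueFlipRotFixed? j m ∘ toList) (allColorings N) to-list from-list ⟩
  count (blueFlipRotFixed? j m ∘ toList) (allColorings N)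
    ≡⟨ count-map (blueFlipRotFixed? j m) toList (allColorings N) ⟨
  count (blueFlipRotFixed? j m) (allLists N) ∎
  where
  to-list : ∀ {c} → c ∈ allColorings N → blues c ≡ j × FlipRotFixed m c → BlueFlipRotFixed j m (toList c)
  to-list {c} _ (b , f , r) = trans (sym (blues≡bluesL∘toList c)) b
    , trans (sym (toList-flipC c)) (cong toList f) , trans (sym (toList-rot^ m c)) (cong toList r)
  from-list : ∀ {c} → c ∈ allColorings N → BlueFlipRotFixed j m (toList c) → blues c ≡ j × FlipRotFixed m c
  from-list {c} _ (b , f , r) = trans (blues≡bluesL∘toList c) b
    , toList-injective (trans (toList-flipC c) f) , toList-injective (trans (toList-rot^ m c) r)

count-rotL^-fixed≡count-period : ∀ t .{{_ : NonZero t}} m j {N} → N ≡ t * m →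
  count (blueFlipRotFixed? j m) (allLists N) ≡ count (λ w → (flipL w ≟L w) ×-dec (t * bluesL w ≟ j)) (allLists m)
count-rotL^-fixed≡count-period (suc t) m j {N} N≡ = count-≡-by-inverses _≟L_ _≟L_ _ _ (take m) (repeat (suc t))
  (allLists-unique N) (allLists-unique m) period-maps-to repeat-maps-to
  (λ xs∈ (_ , _ , r) → rotL^-fixed⇒repeat t m _ (trans (∈allLists⇒length xs∈) N≡) r)
  (λ {w} w∈ _ → subst (λ k → take k (repeat (suc t) w) ≡ w) (∈allLists⇒length w∈) (take-repeat t w))
  where
  period-maps-to : ∀ {xs} → xs ∈ allLists N → BlueFlipRotFixed j m xs →
                   take m xs ∈ allLists m × flipL (take m xs) ≡ take m xs × suc t * bluesL (take m xs) ≡ j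
  period-maps-to {xs} xs∈ (b , f , r) =
    ∈allLists a |a| , flip-a , trans (sym (bluesL-repeat (suc t) a)) (trans (cong bluesL xs≡) b)
    where
    a : List Bool
    a = take m xs
    xs≡ : repeat (suc t) a ≡ xs
    xs≡ = rotL^-fixed⇒repeat t m xs (trans (∈allLists⇒length xs∈) N≡) r
    |a| : length a ≡ m
    |a| = length-take-≤ m xs (subst (m ≤_) (sym (trans (∈allLists⇒length xs∈) N≡)) (m≤m+n m (t * m)))
    flip-a : flipL a ≡ a
    flip-a = begin
      flipL a                              ≡⟨ take-repeat t (flipL a) ⟨
      take (length (flipL a)) (repeat (suc t) (flipL a))
        ≡⟨ cong₂ take (trans (length-flipL a) |a|) (sym (flipL-repeat (suc t) a)) ⟩
      take m (flipL (repeat (suc t) a))    ≡⟨ cong (take m ∘ flipL) xs≡ ⟩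
      take m (flipL xs)                    ≡⟨ cong (take m) f ⟩
      take m xs                            ∎
  repeat-maps-to : ∀ {w} → w ∈ allLists m → flipL w ≡ w × suc t * bluesL w ≡ j →
                   repeat (suc t) w ∈ allLists N × BlueFlipRotFixed j m (repeat (suc t) w)
  repeat-maps-to {w} w∈ (f , b) =
    ∈allLists _ (trans (length-repeat (suc t) w) (trans (cong (suc t *_) (∈allLists⇒length w∈)) (sym N≡)))
    , trans (bluesL-repeat (suc t) w) b
    , trans (flipL-repeat (suc t) w) (cong (repeat (suc t)) f)
    , subst (λ k → rotL^ k (repeat (suc t) w) ≡ repeat (suc t) w) (∈allLists⇒length w∈) (rotL^-repeat (suc t) w)

count-flipL-fixed≡count-mirror : ∀ {Q : Pred (List Bool) 0ℓ} (Q? : Decidable Q) k →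
  count (λ w → (flipL w ≟L w) ×-dec Q? w) (allLists (suc (2 * k))) ≡ count (Q? ∘ mirror) (allLists (suc k))
count-flipL-fixed≡count-mirror {Q} Q? k = count-≡-by-inverses _≟L_ _≟L_ _ _ (take (suc k)) mirror
  (allLists-unique _) (allLists-unique _) half-maps-to mirror-maps-to
  (λ w∈ (f , _) → flipL-fixed⇒mirror k _ (∈allLists⇒length w∈) f)
  take-mirror-∈allLists
  where
  half-maps-to : ∀ {w} → w ∈ allLists (suc (2 * k)) → flipL w ≡ w × Q w →
                 take (suc k) w ∈ allLists (suc k) × Q (mirror (take (suc k) w))
  half-maps-to {w} w∈ (f , q) =
    ∈allLists _ (length-take-≤ (suc k) w (subst (suc k ≤_) (sym (∈allLists⇒length w∈)) (s≤s (m≤m+n k (k + 0)))))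
    , subst Q (sym (flipL-fixed⇒mirror k w (∈allLists⇒length w∈) f)) q
  mirror-maps-to : ∀ {y} → y ∈ allLists (suc k) → Q (mirror y) →
                   mirror y ∈ allLists (suc (2 * k)) × flipL (mirror y) ≡ mirror y × Q (mirror y)
  mirror-maps-to {[]}    y∈ _ with () ← ∈allLists⇒length y∈
  mirror-maps-to {x ∷ u} y∈ q =
    ∈allLists _ (trans (length-mirror x u) (cong (λ l → suc (2 * l)) (suc-injective (∈allLists⇒length y∈))))
    , flipL-mirror (x ∷ u) , q
  take-mirror-∈allLists : ∀ {y} → y ∈ allLists (suc k) → Q (mirror y) → take (suc k) (mirror y) ≡ y
  take-mirror-∈allLists {[]}    y∈ _ with () ← ∈allLists⇒length y∈
  take-mirror-∈allLists {x ∷ u} y∈ _ =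
    subst (λ l → take (suc l) (mirror (x ∷ u)) ≡ x ∷ u) (suc-injective (∈allLists⇒length y∈)) (take-mirror x u)

count-allColorings-suc : ∀ {P : Pred (Coloring (suc n)) 0ℓ} (P? : Decidable P) →
  count P? (allColorings (suc n)) ≡ count (P? ∘ (true ∷_)) (allColorings n) + count (P? ∘ (false ∷_)) (allColorings n)
count-allColorings-suc {n} P? = begin
  count P? (map (true ∷_) (allColorings n) ++ map (false ∷_) (allColorings n))
    ≡⟨ count-++ P? (map (true ∷_) (allColorings n)) (map (false ∷_) (allColorings n)) ⟩
  count P? (map (true ∷_) (allColorings n)) + count P? (map (false ∷_) (allColorings n))
    ≡⟨ cong₂ _+_ (count-map P? (true ∷_) (allColorings n)) (count-map P? (false ∷_) (allColorings n)) ⟩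
  count (P? ∘ (true ∷_)) (allColorings n) + count (P? ∘ (false ∷_)) (allColorings n) ∎

count-mirror≡fibreCounts : ∀ (F : ℕ → ℕ) j k → count (λ y → F (bluesL (mirror y)) ≟ j) (allLists (suc k)) ≡
  fibreCount k (λ b → F (suc (2 * b))) j + fibreCount k (λ b → F (2 * b)) j
count-mirror≡fibreCounts F j k = begin
  count P? (allLists (suc k))
    ≡⟨ count-map P? toList (allColorings (suc k)) ⟩
  count (P? ∘ toList) (allColorings (suc k))
    ≡⟨ count-allColorings-suc {k} (P? ∘ toList) ⟩
  count (P? ∘ toList ∘ (true ∷_)) (allColorings k) + count (P? ∘ toList ∘ (false ∷_)) (allColorings k)
    ≡⟨ cong₂ _+_ (count-cong _ _ (allColorings k) (λ {u} _ → trans (cong (F ∘ suc) (sym (blues-half u))))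
                                                 (λ {u} _ → trans (cong (F ∘ suc) (blues-half u))))
                 (count-cong _ _ (allColorings k) (λ {u} _ → trans (cong F (sym (blues-half u))))
                                                 (λ {u} _ → trans (cong F (blues-half u)))) ⟩
  fibreCount k (λ b → F (suc (2 * b))) j + fibreCount k (λ b → F (2 * b)) j ∎
  where
  P? : Decidable (λ y → F (bluesL (mirror y)) ≡ j)
  P? = λ y → F (bluesL (mirror y)) ≟ j
  blues-half : ∀ {k} (u : Coloring k) → bluesL (toList u ++ reverse (toList u)) ≡ 2 * blues u
  blues-half u = trans (bluesL-++-reverse (toList u)) (cong (2 *_) (sym (blues≡bluesL∘toList u)))

-- Fibres of the blue count

count-blues : ∀ k b → count (λ u → blues u ≟ b) (allColorings k) ≡ k C b
count-blues zero    zero    = refl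
count-blues zero    (suc b) = refl
count-blues (suc k) b = trans (count-allColorings-suc {k} (λ u → blues u ≟ b)) (pascal b)
  where
  pascal : ∀ b → count (λ u → suc (blues u) ≟ b) (allColorings k) + count (λ u → blues u ≟ b) (allColorings k) ≡
                 suc k C b
  pascal zero    = cong₂ _+_
    (count-none (λ u → suc (blues u) ≟ 0) (allColorings k) (All.tabulate λ _ ()))
    (count-blues k 0)
  pascal (suc b) = begin
    count (λ u → suc (blues u) ≟ suc b) (allColorings k) + count (λ u → blues u ≟ suc b) (allColorings k)
      ≡⟨ cong (_+ count (λ u → blues u ≟ suc b) (allColorings k))
              (count-cong _ (λ u → blues u ≟ b) (allColorings k) (λ _ → suc-injective) (λ _ → cong suc)) ⟩
    count (λ u → blues u ≟ b) (allColorings k) + count (λ u → blues u ≟ suc b) (allColorings k)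
      ≡⟨ cong₂ _+_ (count-blues k b) (count-blues k (suc b)) ⟩
    k C b + k C suc b
      ≡⟨ nCk+nC[k+1]≡[n+1]C[k+1] k b ⟩
    suc k C suc b ∎

fibreCount-unique : ∀ k F j b₀ → (∀ {b} → F b ≡ j → b ≡ b₀) → F b₀ ≡ j → fibreCount k F j ≡ k C b₀
fibreCount-unique k F j b₀ only-b₀ Fb₀≡j = trans
  (count-cong _ (λ u → blues u ≟ b₀) (allColorings k)
    (λ _ → only-b₀) (λ _ b≡b₀ → trans (cong F b≡b₀) Fb₀≡j))
  (count-blues k b₀)

fibreCount-empty : ∀ k F j → (∀ b → F b ≢ j) → fibreCount k F j ≡ 0
fibreCount-empty k F j F≢j = count-none (λ u → F (blues u) ≟ j) (allColorings k) (All.tabulate λ {u} _ → F≢j (blues u))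

fibreCount-cong : ∀ k j {F G : ℕ → ℕ} → (∀ b → F b ≡ G b) → fibreCount k F j ≡ fibreCount k G j
fibreCount-cong k j F≗G = count-cong _ _ (allColorings k)
  (λ {u} _ → trans (sym (F≗G (blues u)))) (λ {u} _ → trans (F≗G (blues u)))

fibreCount-*-∣ : ∀ k d .{{_ : NonZero d}} j → d ∣ j → fibreCount k (d *_) j ≡ k C (j / d)
fibreCount-*-∣ k d j d∣j = fibreCount-unique k (d *_) j (j / d)
  (λ {b} db≡j → *-cancelˡ-≡ b (j / d) d (trans db≡j (sym (m*[n/m]≡n d∣j)))) (m*[n/m]≡n d∣j)

fibreCount-*-∤ : ∀ k d j → ¬ d ∣ j → fibreCount k (d *_) j ≡ 0
fibreCount-*-∤ k d j d∤j = fibreCount-empty k (d *_) j λ b db≡j → d∤j (divides b (trans (sym db≡j) (*-comm d b)))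

fibreCount-2^*odd : ∀ k v m {j} → j ≡ 2 ^ v * suc (2 * m) → fibreCount k (λ b → 2 ^ v * suc (2 * b)) j ≡ k C m
fibreCount-2^*odd k v m j≡ = fibreCount-unique k _ _ m (λ {b} eq → proj₂ (odd-part-unique v v b m (trans eq j≡))) (sym j≡)

fibreCount-2^*odd-≢ : ∀ k v w m {j} → v ≢ w → j ≡ 2 ^ w * suc (2 * m) →
                      fibreCount k (λ b → 2 ^ v * suc (2 * b)) j ≡ 0
fibreCount-2^*odd-≢ k v w m v≢w j≡ = fibreCount-empty k _ _ λ b eq → v≢w (proj₁ (odd-part-unique v w b m (trans eq j≡)))

fibreSum : ℕ → ℕ → ℕ → ℕ
fibreSum k v j = fibreCount k (λ b → 2 ^ v * suc (2 * b)) j + fibreCount k (2 ^ suc v *_) j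

length-OrbOddFixed≡fibreSum : ∀ {n} v k j → suc n ≡ 2 ^ v * suc (2 * k) →
                              length (OrbOddFixed (suc n) j) ≡ fibreSum k v j
length-OrbOddFixed≡fibreSum {n} v k j N≡ = begin
  length (OrbOddFixed (suc n) j)
    ≡⟨ length-OrbOddFixed≡count-FlipRotFixed ([1+2*m]%2≡1 k)
         (λ {q} q-odd q∣N → odd∣2^*⇒∣ v q-odd (subst (q ∣_) N≡ q∣N)) j ⟩
  count (flipRotFixed? m) (Neck (suc n) j)
    ≡⟨ count-FlipRotFixed≡count-allLists {suc n} m j ⟩
  count (blueFlipRotFixed? j m) (allLists (suc n))
    ≡⟨ count-rotL^-fixed≡count-period (2 ^ v) m j N≡ ⟩
  count (λ w → (flipL w ≟L w) ×-dec (2 ^ v * bluesL w ≟ j)) (allLists m)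
    ≡⟨ count-flipL-fixed≡count-mirror (λ w → 2 ^ v * bluesL w ≟ j) k ⟩
  count (λ y → 2 ^ v * bluesL (mirror y) ≟ j) (allLists (suc k))
    ≡⟨ count-mirror≡fibreCounts (2 ^ v *_) j k ⟩
  fibreCount k (λ b → 2 ^ v * suc (2 * b)) j + fibreCount k (λ b → 2 ^ v * (2 * b)) j
    ≡⟨ cong (fibreCount k (λ b → 2 ^ v * suc (2 * b)) j +_) (fibreCount-cong k j 2^v*[2*b]≡2^[1+v]*b) ⟩
  fibreSum k v j ∎
  where
  m : ℕ
  m = suc (2 * k)
  instance
    2^v≢0 : NonZero (2 ^ v)
    2^v≢0 = m^n≢0 2 v
  2^v*[2*b]≡2^[1+v]*b : ∀ b → 2 ^ v * (2 * b) ≡ 2 ^ suc v * b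
  2^v*[2*b]≡2^[1+v]*b b = trans (sym (*-assoc (2 ^ v) 2 b)) (cong (_* b) (*-comm (2 ^ v) 2))

module _ (k v : ℕ) .{{_ : NonZero (2 ^ suc v)}} where

  fibreSum-zero : fibreSum k v 0 ≡ k C (0 / 2 ^ suc v)
  fibreSum-zero = cong₂ _+_
    (fibreCount-empty k _ 0 λ b → ≢-nonZero⁻¹ _ {{m*n≢0 (2 ^ v) (suc (2 * b)) {{m^n≢0 2 v}}}})
    (fibreCount-*-∣ k (2 ^ suc v) 0 (divides 0 refl))

  fibreSum-< : ∀ {w m j} → v < w → j ≡ 2 ^ w * suc (2 * m) → fibreSum k v j ≡ k C (j / 2 ^ suc v)
  fibreSum-< {w} {m} v<w j≡ = cong₂ _+_
    (fibreCount-2^*odd-≢ k v w m (<⇒≢ v<w) j≡)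
    (fibreCount-*-∣ k (2 ^ suc v) _ (subst (2 ^ suc v ∣_) (sym j≡) (2^a∣2^b* (suc (2 * m)) v<w)))

  fibreSum-> : ∀ {w m j} → w < v → j ≡ 2 ^ w * suc (2 * m) → fibreSum k v j ≡ 0
  fibreSum-> {w} {m} w<v j≡ = cong₂ _+_
    (fibreCount-2^*odd-≢ k v w m (≢-sym (<⇒≢ w<v)) j≡)
    (fibreCount-*-∤ k (2 ^ suc v) _ λ 2^[1+v]∣j →
      <-asym w<v (2^a∣2^b*odd⇒a≤b (suc v) w m (subst (2 ^ suc v ∣_) j≡ 2^[1+v]∣j)))

  fibreSum-≡ : ∀ {m j} → j ≡ 2 ^ v * suc (2 * m) → fibreSum k v j ≡ k C m
  fibreSum-≡ {m} j≡ = trans (cong₂ _+_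
    (fibreCount-2^*odd k v m j≡)
    (fibreCount-*-∤ k (2 ^ suc v) _ λ 2^[1+v]∣j →
      <-irrefl refl (2^a∣2^b*odd⇒a≤b (suc v) v m (subst (2 ^ suc v ∣_) j≡ 2^[1+v]∣j))))
    (+-identityʳ (k C m))

-- The two boolean comparisons abstracted below are the conditions of the if-then-else in rhs.
fibreSum≡rhs : ∀ n k j → suc n ≡ 2 ^ ν₂-fuel (suc n) (suc n) * suc (2 * k) →
  fibreSum k (ν₂-fuel (suc n) (suc n)) j ≡ rhs (suc n) j
fibreSum≡rhs n k zero N≡ =
  trans (fibreSum-zero k v) (cong (_C (0 / 2 ^ suc v)) (sym (odd-part-half v k N≡)))
  where
  v : ℕ
  v = ν₂-fuel (suc n) (suc n)
  instance
    2^v≢0 : NonZero (2 ^ v)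
    2^v≢0 = m^n≢0 2 v
    2^[1+v]≢0 : NonZero (2 ^ suc v)
    2^[1+v]≢0 = m^n≢0 2 (suc v)
fibreSum≡rhs n k (suc j) N≡ with m , J≡ ← ν₂-odd-part j
                              | ν₂-fuel (suc n) (suc n) <ᵇ ν₂-fuel (suc j) (suc j) in v<ᵇw
                              | ν₂-fuel (suc j) (suc j) <ᵇ ν₂-fuel (suc n) (suc n) in w<ᵇv
... | true  | _     = trans (fibreSum-< k v {m = m} (<ᵇ⇒< v w (subst T (sym v<ᵇw) _)) J≡)
  (cong (_C (suc j / 2 ^ suc v)) (sym (odd-part-half v k N≡)))
  where
  v : ℕ
  v = ν₂-fuel (suc n) (suc n)
  w : ℕ
  w = ν₂-fuel (suc j) (suc j)
  instance
    2^v≢0 : NonZero (2 ^ v)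
    2^v≢0 = m^n≢0 2 v
    2^[1+v]≢0 : NonZero (2 ^ suc v)
    2^[1+v]≢0 = m^n≢0 2 (suc v)
... | false | true  = fibreSum-> k v {{m^n≢0 2 (suc v)}} {m = m} (<ᵇ⇒< w v (subst T (sym w<ᵇv) _)) J≡
  where
  v : ℕ
  v = ν₂-fuel (suc n) (suc n)
  w : ℕ
  w = ν₂-fuel (suc j) (suc j)
... | false | false = trans (fibreSum-≡ k v {m = m} (subst (λ a → suc j ≡ 2 ^ a * suc (2 * m)) (sym v≡w) J≡))
  (cong₂ _C_ (sym (odd-part-half w k (subst (λ a → suc n ≡ 2 ^ a * suc (2 * k)) v≡w N≡)))
             (sym (odd-part-half w m J≡)))
  where
  v : ℕ
  v = ν₂-fuel (suc n) (suc n)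
  w : ℕ
  w = ν₂-fuel (suc j) (suc j)
  instance
    2^w≢0 : NonZero (2 ^ w)
    2^w≢0 = m^n≢0 2 w
    2^[1+v]≢0 : NonZero (2 ^ suc v)
    2^[1+v]≢0 = m^n≢0 2 (suc v)
  v≡w : v ≡ w
  v≡w = ≤-antisym (≮⇒≥ λ w<v → subst T w<ᵇv (<⇒<ᵇ w<v)) (≮⇒≥ λ v<w → subst T v<ᵇw (<⇒<ᵇ v<w))

lemma3p20 : (n j : ℕ) → 1 ≤ n → j ≤ n →
    length (OrbOddFixed n j) ≡ rhs n j
lemma3p20 (suc n) j _ _ with k , N≡ ← ν₂-odd-part n =
  trans (length-OrbOddFixed≡fibreSum (ν₂-fuel (suc n) (suc n)) k j N≡) (fibreSum≡rhs n k j N≡)
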